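{- In the setting below, let $k_1>k_2$ and $t\le k_1$ be positive integers, let $i_1\in H_{k_1}$, let $i_2\in M\setminus H_{k_2}$, and let $j\in J_{i_1,\ge t}$. Then $p_j/s_{i_2}>(k_1-k_2-t)\cdot C^*$.
   Context: Setting: machines $M=\{1,\dots,m\}$ with speeds $s_1\ge s_2\ge\dots\ge s_m>0$ (unrestricted related machines), jobs with processing requirements $p_j\in[0,1]$; job $j$ on machine $i$ takes time $p_j/s_i$. For a schedule, $J_i$ is the set of jobs on machine $i$ and $L_i=\sum_{j\in J_i}p_j/s_i$ its load. $C^*>0$ is the optimal makespan. Fix a schedule $\sigma$ that is a near list schedule: the jobs are indexed $1,\dots,n$ such that, with $J_{i,j}=J_i\cap\{1,\dots,j\}$, for all machines $i'\ne i$ and all $j\in J_i$: $L_{i'}+p_j/s_{i'}\ge L_i-\sum_{\ell\in J_{i,j-1}}p_\ell/s_i$ (all of $J_i,L_i,J_{i,j}$ refer to $\sigma$). For each integer $k$ let $H_k=\{i\in M: L_{i'}\ge kC^*\text{ for all }i'\le i\}$ (an initial segment of $M$; $H_k=M$ for $k\le0$). For a machine $i$ and integer $t$ with $L_i\ge tC^*$, let $j_i^t=\min\{j:\sum_{\ell\in J_{i,j}}p_\ell/s_i\ge tC^*\}$ and $J_{i,\ge t}=J_{i,j_i^t}$.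
   Formalization: The speeds $s_i$, the processing requirements $p_j$ and the optimal makespan $C^*$ take rational values. -}

module Defs where

open import Data.Nat using (ℕ; zero; suc)
import Data.Nat as ℕ
open import Data.Fin using (Fin; toℕ)
open import Data.List using (List; foldr; allFin)
open import Data.Integer using (ℤ)
open import Data.Rational using (ℚ; 0ℚ; _+_; _*_; _÷_; _⊔_; _≤_; _<_; >-nonZero)
open import Data.Product using (Σ; _×_)
open import Relation.Binary.PropositionalEquality using (_≡_; _≢_)
open import Relation.Nullary using (yes; no)
import Data.Fin as Fin

-- Machines are Fin m (machine 1 of the paper is Fin index 0),
-- jobs are Fin n; the job index order is the order of the near list
-- schedule (job 1 of the paper is Fin index 0).

Σℚ : {n : ℕ} → (Fin n → ℚ) → ℚ
Σℚ {n} f = foldr (λ x acc → f x + acc) 0ℚ (allFin n)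

-- maximum over machines (all values considered are ≥ 0, so the base 0 is harmless)
maxℚ : {m : ℕ} → (Fin m → ℚ) → ℚ
maxℚ {m} f = foldr (λ x acc → f x ⊔ acc) 0ℚ (allFin m)

ptime : (p s : ℚ) → 0ℚ < s → ℚ
ptime p s s>0 = _÷_ p s {{>-nonZero s>0}}

Schedule : ℕ → ℕ → Set
Schedule m n = Fin n → Fin m

contrib : {m n : ℕ} (s : Fin m → ℚ) (s>0 : ∀ i → 0ℚ < s i) (p : Fin n → ℚ)
          (σ : Schedule m n) (i : Fin m) (k : ℕ) (ℓ : Fin n) → ℚ
contrib s s>0 p σ i k ℓ with σ ℓ Fin.≟ i | toℕ ℓ ℕ.<? k
... | yes _ | yes _ = ptime (p ℓ) (s i) (s>0 i)
... | _     | _     = 0ℚ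

-- With 0-based job indices: the paper's Σ_{ℓ∈J_{i,j}} p_ℓ/s_i for the job
-- with Fin index j is  prefLoad ... σ i (suc (toℕ j)), and
-- Σ_{ℓ∈J_{i,j-1}} p_ℓ/s_i  is  prefLoad ... σ i (toℕ j).
prefLoad : {m n : ℕ} (s : Fin m → ℚ) (s>0 : ∀ i → 0ℚ < s i) (p : Fin n → ℚ)
           (σ : Schedule m n) (i : Fin m) (k : ℕ) → ℚ
prefLoad s s>0 p σ i k = Σℚ (contrib s s>0 p σ i k)

load : {m n : ℕ} (s : Fin m → ℚ) (s>0 : ∀ i → 0ℚ < s i) (p : Fin n → ℚ)
       (σ : Schedule m n) (i : Fin m) → ℚ
load {n = n} s s>0 p σ i = prefLoad s s>0 p σ i n

makespan : {m n : ℕ} (s : Fin m → ℚ) (s>0 : ∀ i → 0ℚ < s i) (p : Fin n → ℚ)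
           (σ : Schedule m n) → ℚ
makespan s s>0 p σ = maxℚ (load s s>0 p σ)

IsOptMakespan : {m n : ℕ} (s : Fin m → ℚ) (s>0 : ∀ i → 0ℚ < s i) (p : Fin n → ℚ)
                (C : ℚ) → Set
IsOptMakespan {m} {n} s s>0 p C =
  Σ (Schedule m n) (λ τ → makespan s s>0 p τ ≡ C) ×
  (∀ (τ : Schedule m n) → C ≤ makespan s s>0 p τ)

IsNearListSchedule : {m n : ℕ} (s : Fin m → ℚ) (s>0 : ∀ i → 0ℚ < s i) (p : Fin n → ℚ)
                     (σ : Schedule m n) → Set
IsNearListSchedule {m} {n} s s>0 p σ =
  ∀ (i i' : Fin m) (j : Fin n) → i' ≢ i → σ j ≡ i →
    Data.Rational._-_ (load s s>0 p σ i) (prefLoad s s>0 p σ i (toℕ j))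
      ≤ load s s>0 p σ i' + ptime (p j) (s i') (s>0 i')

ℤtoℚ : ℤ → ℚ
ℤtoℚ z = Data.Rational._/_ z 1

InH : {m n : ℕ} (s : Fin m → ℚ) (s>0 : ∀ i → 0ℚ < s i) (p : Fin n → ℚ)
      (σ : Schedule m n) (C : ℚ) (k : ℤ) (i : Fin m) → Set
InH {m} s s>0 p σ C k i =
  ∀ (i' : Fin m) → toℕ i' ℕ.≤ toℕ i → ℤtoℚ k * C ≤ load s s>0 p σ i'

IsJit : {m n : ℕ} (s : Fin m → ℚ) (s>0 : ∀ i → 0ℚ < s i) (p : Fin n → ℚ)
        (σ : Schedule m n) (C : ℚ) (t : ℤ) (i : Fin m) (jt : Fin n) → Set
IsJit {m} {n} s s>0 p σ C t i jt =
  (ℤtoℚ t * C ≤ prefLoad s s>0 p σ i (suc (toℕ jt))) ×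
  (∀ (j' : Fin n) → ℤtoℚ t * C ≤ prefLoad s s>0 p σ i (suc (toℕ j')) → toℕ jt ℕ.≤ toℕ j')

InJge : {m n : ℕ} (s : Fin m → ℚ) (s>0 : ∀ i → 0ℚ < s i) (p : Fin n → ℚ)
        (σ : Schedule m n) (C : ℚ) (t : ℤ) (i : Fin m) (j : Fin n) → Set
InJge {m} {n} s s>0 p σ C t i j =
  (σ j ≡ i) × Σ (Fin n) (λ jt → IsJit s s>0 p σ C t i jt × (toℕ j ℕ.≤ toℕ jt))

{-# OPTIONS --safe #-}
-- Since i₂ ∉ H_{k₂}, some machine i ≤ i₂ has load below k₂C*; it is not i₁, whose
-- load is at least k₁C*.  The jobs of i₁ before j fill less than tC*, because j
-- comes no later than j_{i₁}^t.  The near list condition for j against i then gives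
--   k₁C* − tC* < L_{i₁} − (load of i₁ before j) ≤ L_i + p_j/s_i < k₂C* + p_j/s_i,
-- and p_j/s_i ≤ p_j/s_{i₂} as s_i ≥ s_{i₂}.
module Submission where

open import Defs
open import Data.Nat using (ℕ; suc)
import Data.Nat as ℕ
import Data.Nat.Properties as ℕP
open import Data.Fin using (Fin; toℕ; inject₁)
import Data.Fin as Fin
open import Data.Fin.Properties using (¬∀⟶∃¬; toℕ-inject₁)
open import Data.Integer using (ℤ; +_; _-_)
import Data.Integer as ℤ
import Data.Integer.Properties as ℤP
open import Data.List using (List; []; _∷_; foldr)
open import Data.Product using (∃; _×_; _,_; proj₁)
open import Data.Rational
  using (ℚ; 0ℚ; 1ℚ; _+_; _*_; -_; _≤_; _<_; 1/_; toℚᵘ; positive; nonNegative; >-nonZero)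
import Data.Rational as ℚ
open import Data.Rational.Properties
import Data.Rational.Unnormalised as ℚᵘ
import Data.Rational.Unnormalised.Properties as ℚᵘP
open import Data.Rational.Solver using (module +-*-Solver)
open import Relation.Binary.PropositionalEquality
open import Relation.Nullary using (¬_; yes; no)
open import Relation.Nullary.Decidable using (_→-dec_)
open import Data.Empty using (⊥-elim)

ℤtoℚᵘ : ℤ → ℚᵘ.ℚᵘ
ℤtoℚᵘ z = ℚᵘ.mkℚᵘ z 0

toℚᵘ-ℤtoℚ : ∀ z → toℚᵘ (ℤtoℚ z) ℚᵘ.≃ ℤtoℚᵘ z
toℚᵘ-ℤtoℚ z = toℚᵘ-fromℚᵘ (ℤtoℚᵘ z)

ℤtoℚ-homo-+ : ∀ a b → ℤtoℚ (a ℤ.+ b) ≡ ℤtoℚ a + ℤtoℚ b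
ℤtoℚ-homo-+ a b = toℚᵘ-injective (begin
  toℚᵘ (ℤtoℚ (a ℤ.+ b))          ≈⟨ toℚᵘ-ℤtoℚ (a ℤ.+ b) ⟩
  ℤtoℚᵘ (a ℤ.+ b)                 ≈⟨ ℚᵘ.*≡* (cong (ℤ._* + 1) (sym (cong₂ ℤ._+_ (ℤP.*-identityʳ a) (ℤP.*-identityʳ b)))) ⟩
  ℤtoℚᵘ a ℚᵘ.+ ℤtoℚᵘ b            ≈⟨ ℚᵘP.+-cong (toℚᵘ-ℤtoℚ a) (toℚᵘ-ℤtoℚ b) ⟨
  toℚᵘ (ℤtoℚ a) ℚᵘ.+ toℚᵘ (ℤtoℚ b) ≈⟨ toℚᵘ-homo-+ (ℤtoℚ a) (ℤtoℚ b) ⟨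
  toℚᵘ (ℤtoℚ a + ℤtoℚ b)          ∎)
  where open ℚᵘP.≃-Reasoning

ℤtoℚ-homo‿- : ∀ a → ℤtoℚ (ℤ.- a) ≡ - ℤtoℚ a
ℤtoℚ-homo‿- a = toℚᵘ-injective (begin
  toℚᵘ (ℤtoℚ (ℤ.- a))  ≈⟨ toℚᵘ-ℤtoℚ (ℤ.- a) ⟩
  ℤtoℚᵘ (ℤ.- a)        ≈⟨ ℚᵘP.-‿cong (toℚᵘ-ℤtoℚ a) ⟨
  ℚᵘ.- toℚᵘ (ℤtoℚ a)   ≈⟨ toℚᵘ-homo‿- (ℤtoℚ a) ⟨
  toℚᵘ (- ℤtoℚ a)      ∎)
  where open ℚᵘP.≃-Reasoning

ℤtoℚ-homo-− : ∀ a b → ℤtoℚ (a - b) ≡ ℤtoℚ a ℚ.- ℤtoℚ b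
ℤtoℚ-homo-− a b = trans (ℤtoℚ-homo-+ a (ℤ.- b)) (cong (_+_ (ℤtoℚ a)) (ℤtoℚ-homo‿- b))

ℤtoℚ-mono-≤ : ∀ {a b} → a ℤ.≤ b → ℤtoℚ a ≤ ℤtoℚ b
ℤtoℚ-mono-≤ {a} {b} a≤b = toℚᵘ-cancel-≤
  (ℚᵘP.≤-respʳ-≃ (ℚᵘP.≃-sym (toℚᵘ-ℤtoℚ b)) (ℚᵘP.≤-respˡ-≃ (ℚᵘP.≃-sym (toℚᵘ-ℤtoℚ a))
    (ℚᵘ.*≤* (ℤP.*-monoʳ-≤-nonNeg (+ 1) a≤b))))

ℤtoℚ-mono-< : ∀ {a b} → a ℤ.< b → ℤtoℚ a < ℤtoℚ b
ℤtoℚ-mono-< {a} {b} a<b = toℚᵘ-cancel-<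
  (ℚᵘP.<-respʳ-≃ (ℚᵘP.≃-sym (toℚᵘ-ℤtoℚ b)) (ℚᵘP.<-respˡ-≃ (ℚᵘP.≃-sym (toℚᵘ-ℤtoℚ a))
    (ℚᵘ.*<* (ℤP.*-monoʳ-<-pos (+ 1) a<b))))

ℤtoℚ-−-−-* : ∀ a b c C →
  ℤtoℚ (a - b - c) * C ≡ ℤtoℚ a * C ℚ.- ℤtoℚ b * C ℚ.- ℤtoℚ c * C
ℤtoℚ-−-−-* a b c C = begin
  ℤtoℚ (a - b - c) * C
    ≡⟨ cong (_* C) (trans (ℤtoℚ-homo-− (a - b) c) (cong (ℚ._- ℤtoℚ c) (ℤtoℚ-homo-− a b))) ⟩
  (ℤtoℚ a ℚ.- ℤtoℚ b ℚ.- ℤtoℚ c) * C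
    ≡⟨ solve 4 (λ x y z w → (x :- y :- z) :* w := x :* w :- y :* w :- z :* w)
             refl (ℤtoℚ a) (ℤtoℚ b) (ℤtoℚ c) C ⟩
  ℤtoℚ a * C ℚ.- ℤtoℚ b * C ℚ.- ℤtoℚ c * C ∎
  where
  open ≡-Reasoning
  open +-*-Solver

sub-sub-<-of-≤-+ : ∀ {u v w a b c x} → u ≤ a → b < v → c < w → a ℚ.- c ≤ b + x →
                   u ℚ.- v ℚ.- w < x
sub-sub-<-of-≤-+ {u} {v} {w} {a} {b} {c} {x} u≤a b<v c<w a-c≤b+x = begin-strict
  u ℚ.- v ℚ.- w    <⟨ +-mono-<-≤ (+-mono-≤-< u≤a (neg-antimono-< b<v)) (neg-antimono-≤ (<⇒≤ c<w)) ⟩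
  a ℚ.- b ℚ.- c    ≡⟨ solve 3 (λ a b c → a :- b :- c := (a :- c) :- b) refl a b c ⟩
  a ℚ.- c ℚ.- b    ≤⟨ +-monoˡ-≤ (- b) a-c≤b+x ⟩
  b + x ℚ.- b      ≡⟨ solve 2 (λ b x → b :+ x :- b := x) refl b x ⟩
  x                ∎
  where
  open ≤-Reasoning
  open +-*-Solver

1/-pos : ∀ {r} (r>0 : 0ℚ < r) → 0ℚ < (1/ r) {{>-nonZero r>0}}
1/-pos {r} r>0 = positive⁻¹ _ {{1/pos⇒pos r {{positive r>0}}}}

1/-antimono-≤-pos : ∀ {r s} (r>0 : 0ℚ < r) (s>0 : 0ℚ < s) → r ≤ s →
                    (1/ s) {{>-nonZero s>0}} ≤ (1/ r) {{>-nonZero r>0}}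
1/-antimono-≤-pos {r} {s} r>0 s>0 r≤s = begin
  b              ≡⟨ sym (*-identityˡ b) ⟩
  1ℚ * b         ≡⟨ cong (_* b) (sym (*-inverseʳ r)) ⟩
  (r * a) * b    ≡⟨ *-assoc r a b ⟩
  r * (a * b)    ≤⟨ *-monoʳ-≤-nonNeg (a * b) r≤s ⟩
  s * (a * b)    ≡⟨ cong (s *_) (*-comm a b) ⟩
  s * (b * a)    ≡⟨ sym (*-assoc s b a) ⟩
  (s * b) * a    ≡⟨ cong (_* a) (*-inverseʳ s) ⟩
  1ℚ * a         ≡⟨ *-identityˡ a ⟩
  a              ∎
  where
  open ≤-Reasoning
  instance
    _ = >-nonZero r>0
    _ = >-nonZero s>0
  a = 1/ r
  b = 1/ s
  instance
    _ = nonNeg*nonNeg⇒nonNeg a {{nonNegative (<⇒≤ (1/-pos r>0))}} b {{nonNegative (<⇒≤ (1/-pos s>0))}}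

ptime-nonNeg : ∀ {q s} (s>0 : 0ℚ < s) → 0ℚ ≤ q → 0ℚ ≤ ptime q s s>0
ptime-nonNeg {q} {s} s>0 q≥0 = nonNegative⁻¹ _
  {{nonNeg*nonNeg⇒nonNeg q {{nonNegative q≥0}} _ {{nonNegative (<⇒≤ (1/-pos s>0))}}}}

ptime-antimono-≤ : ∀ {q r s} (r>0 : 0ℚ < r) (s>0 : 0ℚ < s) → 0ℚ ≤ q → r ≤ s →
                   ptime q s s>0 ≤ ptime q r r>0
ptime-antimono-≤ {q} r>0 s>0 q≥0 r≤s =
  *-monoˡ-≤-nonNeg q {{nonNegative q≥0}} (1/-antimono-≤-pos r>0 s>0 r≤s)

foldr-+-mono-≤ : ∀ {A : Set} {f g : A → ℚ} → (∀ x → f x ≤ g x) → (xs : List A) →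
  foldr (λ x acc → f x + acc) 0ℚ xs ≤ foldr (λ x acc → g x + acc) 0ℚ xs
foldr-+-mono-≤ f≤g []       = ≤-refl
foldr-+-mono-≤ f≤g (x ∷ xs) = +-mono-≤ (f≤g x) (foldr-+-mono-≤ f≤g xs)

foldr-+-zero : ∀ {A : Set} {f : A → ℚ} → (∀ x → f x ≡ 0ℚ) → (xs : List A) →
  foldr (λ x acc → f x + acc) 0ℚ xs ≡ 0ℚ
foldr-+-zero f≡0 []       = refl
foldr-+-zero f≡0 (x ∷ xs) = cong₂ _+_ (f≡0 x) (foldr-+-zero f≡0 xs)

Σℚ-mono-≤ : ∀ {n} {f g : Fin n → ℚ} → (∀ x → f x ≤ g x) → Σℚ f ≤ Σℚ g
Σℚ-mono-≤ {n} f≤g = foldr-+-mono-≤ f≤g (Data.List.allFin n)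

Σℚ-zero : ∀ {n} {f : Fin n → ℚ} → (∀ x → f x ≡ 0ℚ) → Σℚ f ≡ 0ℚ
Σℚ-zero {n} f≡0 = foldr-+-zero f≡0 (Data.List.allFin n)

module _ {m n : ℕ} (s : Fin m → ℚ) (s>0 : ∀ i → 0ℚ < s i) (p : Fin n → ℚ)
         (σ : Schedule m n) where

  contrib-mono-≤ : (∀ j → 0ℚ ≤ p j) → ∀ i {k k'} → k ℕ.≤ k' →
                   ∀ ℓ → contrib s s>0 p σ i k ℓ ≤ contrib s s>0 p σ i k' ℓ
  contrib-mono-≤ p≥0 i {k} {k'} k≤k' ℓ with σ ℓ Fin.≟ i | toℕ ℓ ℕ.<? k | toℕ ℓ ℕ.<? k'
  ... | yes _ | yes _   | yes _   = ≤-refl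
  ... | yes _ | yes ℓ<k | no ℓ≮k' = ⊥-elim (ℓ≮k' (ℕP.<-≤-trans ℓ<k k≤k'))
  ... | yes _ | no _    | yes _   = ptime-nonNeg (s>0 i) (p≥0 ℓ)
  ... | yes _ | no _    | no _    = ≤-refl
  ... | no _  | _       | _       = ≤-refl

  prefLoad-mono-≤ : (∀ j → 0ℚ ≤ p j) → ∀ i {k k'} → k ℕ.≤ k' →
                    prefLoad s s>0 p σ i k ≤ prefLoad s s>0 p σ i k'
  prefLoad-mono-≤ p≥0 i k≤k' = Σℚ-mono-≤ (contrib-mono-≤ p≥0 i k≤k')

  prefLoad-zero : ∀ i → prefLoad s s>0 p σ i 0 ≡ 0ℚ
  prefLoad-zero i = Σℚ-zero contrib-zero
    where
    contrib-zero : ∀ ℓ → contrib s s>0 p σ i 0 ℓ ≡ 0ℚ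
    contrib-zero ℓ with σ ℓ Fin.≟ i | toℕ ℓ ℕ.<? 0
    ... | yes _ | no _ = refl
    ... | no _  | _    = refl

  prefLoad-<-jit : ∀ {C t i} (jt : Fin n) → IsJit s s>0 p σ C t i jt →
                   0ℚ < ℤtoℚ t * C → prefLoad s s>0 p σ i (toℕ jt) < ℤtoℚ t * C
  prefLoad-<-jit {i = i} Fin.zero _ tC>0 =
    ≤-<-trans (≤-reflexive (prefLoad-zero i)) tC>0
  prefLoad-<-jit {C} {t} {i} (Fin.suc r) (_ , minimal) _
    with ℤtoℚ t * C ≤? prefLoad s s>0 p σ i (suc (toℕ r))
  ... | no tC≰ = ≰⇒> tC≰
  ... | yes tC≤ = ⊥-elim (ℕP.1+n≰n (subst (suc (toℕ r) ℕ.≤_) (toℕ-inject₁ r)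
          (minimal (inject₁ r)
            (subst (λ k → ℤtoℚ t * C ≤ prefLoad s s>0 p σ i (suc k)) (sym (toℕ-inject₁ r)) tC≤))))

  prefLoad-<-InJge : (∀ j → 0ℚ ≤ p j) → ∀ {C t i j} → InJge s s>0 p σ C t i j →
                     0ℚ < ℤtoℚ t * C → prefLoad s s>0 p σ i (toℕ j) < ℤtoℚ t * C
  prefLoad-<-InJge p≥0 {C} {t} {i} (_ , jt , isJit , j≤jt) tC>0 =
    ≤-<-trans (prefLoad-mono-≤ p≥0 i j≤jt) (prefLoad-<-jit {C} {t} jt isJit tC>0)

  ¬InH⇒∃-light : ∀ {C k i} → ¬ InH s s>0 p σ C k i →
                 ∃ λ i' → toℕ i' ℕ.≤ toℕ i × load s s>0 p σ i' < ℤtoℚ k * C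
  ¬InH⇒∃-light {C} {k} {i} i∉H
    with ¬∀⟶∃¬ m _ (λ i' → (toℕ i' ℕ.≤? toℕ i) →-dec (ℤtoℚ k * C ≤? load s s>0 p σ i')) i∉H
  ... | i' , ¬heavy with toℕ i' ℕ.≤? toℕ i
  ...   | yes i'≤i = i' , i'≤i , ≰⇒> (λ heavy → ¬heavy (λ _ → heavy))
  ...   | no i'≰i  = ⊥-elim (¬heavy (λ i'≤i → ⊥-elim (i'≰i i'≤i)))

lemma9 : {m n : ℕ} (s : Fin m → ℚ) (s>0 : ∀ i → 0ℚ < s i)
    → (∀ (i i' : Fin m) → toℕ i ℕ.≤ toℕ i' → s i' ≤ s i)
    → (p : Fin n → ℚ) → (∀ j → 0ℚ ≤ p j) → (∀ j → p j ≤ 1ℚ)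
    → (C : ℚ) → 0ℚ < C → IsOptMakespan s s>0 p C
    → (σ : Fin n → Fin m) → IsNearListSchedule s s>0 p σ
    → (k₁ k₂ t : ℕ) → 1 ℕ.≤ k₂ → k₂ ℕ.< k₁ → 1 ℕ.≤ t → t ℕ.≤ k₁
    → (i₁ i₂ : Fin m) → InH s s>0 p σ C (+ k₁) i₁ → ¬ InH s s>0 p σ C (+ k₂) i₂
    → (j : Fin n) → InJge s s>0 p σ C (+ t) i₁ j
    → ℤtoℚ (+ k₁ - + k₂ - + t) * C < ptime (p j) (s i₂) (s>0 i₂)
lemma9 s s>0 s-anti p p≥0 _ C C>0 _ σ near k₁ k₂ t _ k₂<k₁ 1≤t _ i₁ i₂ i₁∈H i₂∉H j j∈J
  with ¬InH⇒∃-light s s>0 p σ {C} {+ k₂} i₂∉H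
... | i , i≤i₂ , Lᵢ<k₂C = begin-strict
  ℤtoℚ (+ k₁ - + k₂ - + t) * C
    ≡⟨ ℤtoℚ-−-−-* (+ k₁) (+ k₂) (+ t) C ⟩
  ℤtoℚ (+ k₁) * C ℚ.- ℤtoℚ (+ k₂) * C ℚ.- ℤtoℚ (+ t) * C
    <⟨ sub-sub-<-of-≤-+ k₁C≤Lᵢ₁ Lᵢ<k₂C (prefLoad-<-InJge s s>0 p σ p≥0 {C} {+ t} j∈J tC>0)
                        (near i₁ i j i≢i₁ (proj₁ j∈J)) ⟩
  ptime (p j) (s i) (s>0 i)
    ≤⟨ ptime-antimono-≤ (s>0 i₂) (s>0 i) (p≥0 j) (s-anti i i₂ i≤i₂) ⟩
  ptime (p j) (s i₂) (s>0 i₂) ∎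
  where
  open ≤-Reasoning
  instance _ = positive C>0
  k₁C≤Lᵢ₁ = i₁∈H i₁ ℕP.≤-refl
  i≢i₁ : i ≢ i₁
  i≢i₁ refl = <-irrefl refl (<-≤-trans Lᵢ<k₂C (≤-trans
    (*-monoʳ-≤-nonNeg C {{pos⇒nonNeg C}} (ℤtoℚ-mono-≤ (ℤ.+≤+ (ℕP.<⇒≤ k₂<k₁)))) k₁C≤Lᵢ₁))
  tC>0 : 0ℚ < ℤtoℚ (+ t) * C
  tC>0 = ≤-<-trans (≤-reflexive (sym (*-zeroˡ C))) (*-monoˡ-<-pos C (ℤtoℚ-mono-< (ℤ.+<+ 1≤t)))
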